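{- If the $n$-maniplex $\mathcal K$ is regular, then all the universal Cayley extensions $\mathcal U(\mathcal K,r_n)$ of $\mathcal K$ (over all pre-extenders $(\mathcal K,r_n)$) are isomorphic to each other and regular.
   Context: An $n$-premaniplex is a graph (semi-edges and parallel edges allowed) whose vertices, called flags, carry a proper edge colouring with colours $0,\dots,n-1$, each flag $\Phi$ having exactly one incident dart of each colour $i$, with other end $r_i\Phi$; one requires $r_ir_jr_ir_j=1$ for $|i-j|>1$. An $n$-maniplex is a connected $n$-premaniplex in which $r_i$ and $r_ir_j$ ($i\ne j$) have no fixed points. Facets are components after deleting colour-$(n-1)$ edges. Automorphisms are colour-preserving graph automorphisms; a maniplex is regular if its automorphism group acts transitively on its flags. A pre-extender $(\mathcal K,r_n)$ is a permutation $r_n$ of the flags of $\mathcal K$ with $r_n^2=1$ commuting with $r_0,\dots,r_{n-2}$. The universal Cayley extension $\mathcal U(\mathcal K,r_n)$ is the $(n+1)$-maniplex with flags $(\Phi,\gamma)$, $\Phi$ a flag of $\mathcal K$, $\gamma\in G(\mathcal K,r_n)=\langle\alpha_F\ (F\text{ a facet})\mid\alpha_F\alpha_{r_n(F)}=1\rangle$, where $(\Phi,\gamma)$ is $i$-adjacent to $(r_i\Phi,\gamma)$ for $i<n$ and $n$-adjacent to $(r_n\Phi,\alpha_F\gamma)$, $F$ the facet of $\Phi$. -}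

module Defs where

open import Level using (0ℓ)
open import Data.Nat using (ℕ; zero; suc; _<_)
open import Data.Fin using (Fin; zero; suc; toℕ)
open import Data.List using (List; []; _∷_; _++_)
open import Data.List.Relation.Unary.All using (All)
open import Data.Bool using (Bool; true; false)
open import Data.Maybe using (Maybe; just; nothing)
import Data.Maybe as Maybe
open import Data.Product using (Σ; ∃; _×_; _,_; proj₁; proj₂)
open import Data.Sum using (_⊎_)
open import Relation.Binary.Bundles using (Setoid)
open import Relation.Binary.PropositionalEquality using (_≡_)
open import Relation.Nullary using (¬_)

-- Flags live in a setoid
-- (there are no quotient types), so all equations are up to _≈_.

record RawPremaniplex (n : ℕ) : Set₁ where
  field
    flags : Setoid 0ℓ 0ℓ
  open Setoid flags public renaming (Carrier to Flag)
  field
    r : Fin n → Flag → Flag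

open RawPremaniplex public using () renaming (Flag to FlagOf; r to adj)

FarApart : ∀ {n} → Fin n → Fin n → Set
FarApart i j = suc (toℕ i) < toℕ j ⊎ suc (toℕ j) < toℕ i

NotTop : ∀ {n} → Fin n → Set
NotTop {n} i = suc (toℕ i) < n

applyWord : ∀ {n} (M : RawPremaniplex n) → List (Fin n) → FlagOf M → FlagOf M
applyWord M []       x = x
applyWord M (i ∷ is) x = applyWord M is (adj M i x)

record IsManiplex {n} (M : RawPremaniplex n) : Set where
  open RawPremaniplex M
  field
    r-cong    : ∀ i {x y} → x ≈ y → r i x ≈ r i y
    r-invol   : ∀ i x → r i (r i x) ≈ x
    r-comm    : ∀ i j x → FarApart i j → r i (r j (r i (r j x))) ≈ x
    r-nofix   : ∀ i x → ¬ (r i x ≈ x)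
    rr-nofix  : ∀ i j x → ¬ (i ≡ j) → ¬ (r i (r j x) ≈ x)
    connected : ∀ x y → ∃ λ (w : List (Fin n)) → applyWord M w x ≈ y

record Iso {n} (M N : RawPremaniplex n) : Set where
  module M = RawPremaniplex M
  module N = RawPremaniplex N
  field
    fwd      : M.Flag → N.Flag
    bwd      : N.Flag → M.Flag
    fwd-cong : ∀ {x y} → x M.≈ y → fwd x N.≈ fwd y
    bwd-cong : ∀ {x y} → x N.≈ y → bwd x M.≈ bwd y
    bwd-fwd  : ∀ x → bwd (fwd x) M.≈ x
    fwd-bwd  : ∀ y → fwd (bwd y) N.≈ y
    fwd-r    : ∀ i x → fwd (M.r i x) N.≈ N.r i (fwd x)

open Iso public using () renaming (fwd to fwdOf)

Regular : ∀ {n} (M : RawPremaniplex n) → Set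
Regular M = ∀ (x y : FlagOf M) →
  Σ (Iso M M) λ φ → RawPremaniplex._≈_ M (fwdOf φ x) y

record PreExtender {n} (K : RawPremaniplex n) : Set where
  open RawPremaniplex K
  field
    rn       : Flag → Flag
    rn-cong  : ∀ {x y} → x ≈ y → rn x ≈ rn y
    rn-invol : ∀ x → rn (rn x) ≈ x
    rn-comm  : ∀ i x → NotTop i → rn (r i x) ≈ r i (rn x)

open PreExtender public using () renaming (rn to rnOf)

-- Φ and Ψ lie in the same facet (same component after deleting
-- colour-(n-1) edges)
SameFacet : ∀ {n} (K : RawPremaniplex n) → FlagOf K → FlagOf K → Set
SameFacet {n} K Φ Ψ =
  ∃ λ (w : List (Fin n)) → All NotTop w × RawPremaniplex._≈_ K (applyWord K w Φ) Ψ

-- The group G(K, r_n) = ⟨ α_F (F a facet) | α_F α_{r_n F} = 1 ⟩,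
-- presented by words in letters α_Φ^{±1} (Φ a flag; α_Φ stands for
-- α_F with F the facet of Φ), modulo the congruence generated by
-- free cancellation, α_Φ = α_Ψ for Φ, Ψ in the same facet, and
-- α_Φ α_{r_n Φ} = 1.

Letter : ∀ {n} → RawPremaniplex n → Set
Letter K = FlagOf K × Bool   -- (Φ , true) = α_Φ, (Φ , false) = α_Φ⁻¹

Word : ∀ {n} → RawPremaniplex n → Set
Word K = List (Letter K)

data _∼⟨_⟩_ {n} {K : RawPremaniplex n} : Word K → PreExtender K → Word K → Set where
  ∼-refl  : ∀ {P u} → u ∼⟨ P ⟩ u
  ∼-sym   : ∀ {P u v} → u ∼⟨ P ⟩ v → v ∼⟨ P ⟩ u
  ∼-trans : ∀ {P u v w} → u ∼⟨ P ⟩ v → v ∼⟨ P ⟩ w → u ∼⟨ P ⟩ w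
  ∼-cong  : ∀ {P} a {u v} b → u ∼⟨ P ⟩ v → (a ++ u ++ b) ∼⟨ P ⟩ (a ++ v ++ b)
  ∼-inv₁  : ∀ {P} Φ → ((Φ , true) ∷ (Φ , false) ∷ []) ∼⟨ P ⟩ []
  ∼-inv₂  : ∀ {P} Φ → ((Φ , false) ∷ (Φ , true) ∷ []) ∼⟨ P ⟩ []
  ∼-facet : ∀ {P} Φ Ψ → SameFacet K Φ Ψ → ((Φ , true) ∷ []) ∼⟨ P ⟩ ((Ψ , true) ∷ [])
  ∼-ext   : ∀ {P} Φ → ((Φ , true) ∷ (rnOf P Φ , true) ∷ []) ∼⟨ P ⟩ []

-- Colours of an (n+1)-premaniplex: nothing = the new colour n,
-- just j = old colour j < n.

split : ∀ n → Fin (suc n) → Maybe (Fin n)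
split zero    zero    = nothing
split (suc n) zero    = just zero
split (suc n) (suc i) = Maybe.map suc (split n i)

UFlagSetoid : ∀ {n} (K : RawPremaniplex n) → PreExtender K → Setoid 0ℓ 0ℓ
UFlagSetoid K P = record
  { Carrier = FlagOf K × Word K
  ; _≈_ = λ x y → (proj₁ x ≈ proj₁ y) × (proj₂ x ∼⟨ P ⟩ proj₂ y)
  ; isEquivalence = record
    { refl  = refl , ∼-refl
    ; sym   = λ (p , q) → sym p , ∼-sym q
    ; trans = λ (p , q) (p′ , q′) → trans p p′ , ∼-trans q q′
    }
  }
  where open RawPremaniplex K using (_≈_; refl; sym; trans)

Ur : ∀ {n} (K : RawPremaniplex n) → PreExtender K →
     Fin (suc n) → FlagOf K × Word K → FlagOf K × Word K
Ur {n} K P i (Φ , γ) with split n i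
... | just j  = adj K j Φ , γ
... | nothing = rnOf P Φ , (Φ , true) ∷ γ

U : ∀ {n} (K : RawPremaniplex n) → PreExtender K → RawPremaniplex (suc n)
U K P = record { flags = UFlagSetoid K P ; r = Ur K P }

{-# OPTIONS --safe #-}
module Submission where

open import Data.Nat using (ℕ; zero; suc)
open import Data.Fin using (Fin; zero; suc; inject₁; fromℕ)
open import Data.List using (List; []; _∷_; _++_; map)
open import Data.List.Properties using (++-assoc; ++-identityʳ)
open import Data.List.Relation.Unary.All using (All; []; _∷_)
open import Data.Bool using (true; false; not)
open import Data.Maybe using (just; nothing)
import Data.Maybe as Maybe
open import Data.Product using (∃; _×_; _,_; proj₁; proj₂)
open import Level using (0ℓ)
open import Relation.Binary.Bundles using (Setoid)
open import Relation.Binary.PropositionalEquality as ≡ using (_≡_; subst₂)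
import Relation.Binary.Reasoning.Setoid as SetoidReasoning
open import Defs

-- Every automorphism g of a regular K extends to an isomorphism
-- U(K,P) → U(K,Q) sending (Φ, γ) to (aut g γ Φ, word g γ).  Reading γ from
-- the right, aut g γ changes the current automorphism at each letter α_X to
-- the one (given by regularity) carrying the P-neighbour r_n X onto the
-- Q-neighbour of the image of X, and word g γ renames α_X to α_{h X} for the
-- automorphism h current at that letter.  Since an automorphism of a
-- connected maniplex is determined by the image of one flag, both depend
-- only on the element of G(K,P) represented by γ.  The construction for g⁻¹
-- is inverse to it because the composites fix every flag (Φ, 1) of the
-- connected U.  With g = 1 this identifies all the U(K,P); with g Φ = Ψ,
-- composed with right multiplications in G(K,P), it moves (Φ, γ) to (Ψ, δ).

record Hom {n} (M N : RawPremaniplex n) : Set where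
  module M = RawPremaniplex M
  module N = RawPremaniplex N
  field
    fun      : M.Flag → N.Flag
    fun-cong : ∀ {x y} → x M.≈ y → fun x N.≈ fun y
    fun-r    : ∀ i x → fun (M.r i x) N.≈ N.r i (fun x)

AdjCong : ∀ {n} → RawPremaniplex n → Set
AdjCong M = ∀ i {x y} → x ≈ y → r i x ≈ r i y
  where open RawPremaniplex M

Reachable : ∀ {n} (M : RawPremaniplex n) → FlagOf M → FlagOf M → Set
Reachable {n} M x y = ∃ λ (w : List (Fin n)) → applyWord M w x ≈ y
  where open RawPremaniplex M using (_≈_)

applyWord-++ : ∀ {n} (M : RawPremaniplex n) w v x →
               applyWord M (w ++ v) x ≡ applyWord M v (applyWord M w x)
applyWord-++ M []      v x = ≡.refl
applyWord-++ M (i ∷ w) v x = applyWord-++ M w v (adj M i x)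

module _ {n : ℕ} where

  Hom-id : {M : RawPremaniplex n} → Hom M M
  Hom-id {M} = record { fun = λ x → x ; fun-cong = λ p → p ; fun-r = λ i x → refl {r i x} }
    where open RawPremaniplex M

  Hom-∘ : {M N O : RawPremaniplex n} → Hom N O → Hom M N → Hom M O
  Hom-∘ {O = O} g f = record
    { fun      = λ x → fun g (fun f x)
    ; fun-cong = λ p → fun-cong g (fun-cong f p)
    ; fun-r    = λ i x → RawPremaniplex.trans O (fun-cong g (fun-r f i x)) (fun-r g i (fun f x))
    }
    where open Hom

  Iso⇒Hom : {M N : RawPremaniplex n} → Iso M N → Hom M N
  Iso⇒Hom φ = record { fun = Iso.fwd φ ; fun-cong = Iso.fwd-cong φ ; fun-r = Iso.fwd-r φ }

  Iso-fromHoms : {M N : RawPremaniplex n} (f : Hom M N) (f′ : Hom N M) →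
                 (∀ x → RawPremaniplex._≈_ M (Hom.fun f′ (Hom.fun f x)) x) →
                 (∀ y → RawPremaniplex._≈_ N (Hom.fun f (Hom.fun f′ y)) y) → Iso M N
  Iso-fromHoms f f′ f′∘f f∘f′ = record
    { fwd = Hom.fun f ; bwd = Hom.fun f′ ; fwd-cong = Hom.fun-cong f ; bwd-cong = Hom.fun-cong f′
    ; bwd-fwd = f′∘f ; fwd-bwd = f∘f′ ; fwd-r = Hom.fun-r f }

  Iso-id : {M : RawPremaniplex n} → Iso M M
  Iso-id {M} = Iso-fromHoms Hom-id Hom-id (λ _ → refl) (λ _ → refl)
    where open RawPremaniplex M

  Iso-trans : {M N O : RawPremaniplex n} → Iso M N → Iso N O → Iso M O
  Iso-trans {M} {N} {O} φ ψ = record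
    { fwd      = λ x → Iso.fwd ψ (Iso.fwd φ x)
    ; bwd      = λ z → Iso.bwd φ (Iso.bwd ψ z)
    ; fwd-cong = λ p → Iso.fwd-cong ψ (Iso.fwd-cong φ p)
    ; bwd-cong = λ p → Iso.bwd-cong φ (Iso.bwd-cong ψ p)
    ; bwd-fwd  = λ x → M.trans (Iso.bwd-cong φ (Iso.bwd-fwd ψ (Iso.fwd φ x))) (Iso.bwd-fwd φ x)
    ; fwd-bwd  = λ z → O.trans (Iso.fwd-cong ψ (Iso.fwd-bwd φ (Iso.bwd ψ z))) (Iso.fwd-bwd ψ z)
    ; fwd-r    = Hom.fun-r (Hom-∘ (Iso⇒Hom ψ) (Iso⇒Hom φ))
    }
    where
    module M = RawPremaniplex M
    module O = RawPremaniplex O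

  Iso-sym : {M N : RawPremaniplex n} → AdjCong N → Iso M N → Iso N M
  Iso-sym {M} {N} r-cong φ = record
    { fwd = bwd ; bwd = fwd ; fwd-cong = bwd-cong ; bwd-cong = fwd-cong
    ; bwd-fwd = fwd-bwd ; fwd-bwd = bwd-fwd ; fwd-r = bwd-r }
    where
    open Iso φ
    open SetoidReasoning M.flags
    bwd-r : ∀ i y → bwd (N.r i y) M.≈ M.r i (bwd y)
    bwd-r i y = begin
      bwd (N.r i y)             ≈⟨ bwd-cong (r-cong i (fwd-bwd y)) ⟨
      bwd (N.r i (fwd (bwd y))) ≈⟨ bwd-cong (fwd-r i (bwd y)) ⟨
      bwd (fwd (M.r i (bwd y))) ≈⟨ bwd-fwd (M.r i (bwd y)) ⟩
      M.r i (bwd y)             ∎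

  module _ {M : RawPremaniplex n} (r-cong : AdjCong M) where
    open RawPremaniplex M

    applyWord-cong : ∀ w {x y} → x ≈ y → applyWord M w x ≈ applyWord M w y
    applyWord-cong []      p = p
    applyWord-cong (i ∷ w) p = applyWord-cong w (r-cong i p)

    Reachable-trans : ∀ {x y z} → Reachable M x y → Reachable M y z → Reachable M x z
    Reachable-trans {x} (w , p) (v , q) =
      w ++ v , trans (reflexive (applyWord-++ M w v x)) (trans (applyWord-cong v p) q)

  Hom-applyWord : {M N : RawPremaniplex n} → AdjCong N → (f : Hom M N) → ∀ w x →
                  RawPremaniplex._≈_ N (Hom.fun f (applyWord M w x)) (applyWord N w (Hom.fun f x))
  Hom-applyWord {N = N} r-cong f []      x = RawPremaniplex.refl N
  Hom-applyWord {N = N} r-cong f (i ∷ w) x =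
    RawPremaniplex.trans N (Hom-applyWord r-cong f w _) (applyWord-cong r-cong w (Hom.fun-r f i x))

  Hom-agreeOnReachable : {M N : RawPremaniplex n} → AdjCong N → (f g : Hom M N) → ∀ {x y} →
                         RawPremaniplex._≈_ N (Hom.fun f x) (Hom.fun g x) → Reachable M x y →
                         RawPremaniplex._≈_ N (Hom.fun f y) (Hom.fun g y)
  Hom-agreeOnReachable {M} {N} r-cong f g {x} {y} fx≈gx (w , wx≈y) = begin
    fun f y                 ≈⟨ fun-cong f wx≈y ⟨
    fun f (applyWord M w x) ≈⟨ Hom-applyWord r-cong f w x ⟩
    applyWord N w (fun f x) ≈⟨ applyWord-cong r-cong w fx≈gx ⟩
    applyWord N w (fun g x) ≈⟨ Hom-applyWord r-cong g w x ⟨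
    fun g (applyWord M w x) ≈⟨ fun-cong g wx≈y ⟩
    fun g y                 ∎
    where
    open Hom
    open SetoidReasoning (RawPremaniplex.flags N)

  Iso-fromLocalInverses :
    {M N : RawPremaniplex n} → AdjCong M → AdjCong N → (f : Hom M N) (f′ : Hom N M) →
    (∀ y → ∃ λ x → RawPremaniplex._≈_ M (Hom.fun f′ (Hom.fun f x)) x × Reachable M x y) →
    (∀ y → ∃ λ x → RawPremaniplex._≈_ N (Hom.fun f (Hom.fun f′ x)) x × Reachable N x y) →
    Iso M N
  Iso-fromLocalInverses M-cong N-cong f f′ fixM fixN = Iso-fromHoms f f′
    (λ y → let (x , fixed , reach) = fixM y in
           Hom-agreeOnReachable M-cong (Hom-∘ f′ f) Hom-id fixed reach)
    (λ y → let (x , fixed , reach) = fixN y in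
           Hom-agreeOnReachable N-cong (Hom-∘ f f′) Hom-id fixed reach)

module WordRel {n : ℕ} {K : RawPremaniplex n} (R : PreExtender K) where
  open RawPremaniplex K using (_≈_; sym)
  open PreExtender R using (rn; rn-invol)

  infix 4 _∼_
  _∼_ : Word K → Word K → Set
  u ∼ v = u ∼⟨ R ⟩ v

  wordSetoid : Setoid 0ℓ 0ℓ
  wordSetoid = record
    { Carrier = Word K ; _≈_ = _∼_
    ; isEquivalence = record { refl = ∼-refl ; sym = ∼-sym ; trans = ∼-trans } }

  ∼-congʳ : ∀ {u v} b → u ∼ v → u ++ b ∼ v ++ b
  ∼-congʳ b = ∼-cong [] b

  ∼-congˡ : ∀ a {u v} → u ∼ v → a ++ u ∼ a ++ v
  ∼-congˡ a {u} {v} d =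
    subst₂ _∼_ (≡.cong (a ++_) (++-identityʳ u)) (≡.cong (a ++_) (++-identityʳ v)) (∼-cong a [] d)

  ∼-letter : ∀ {X Y} u → X ≈ Y → (X , true) ∷ u ∼ (Y , true) ∷ u
  ∼-letter {X} {Y} u p = ∼-congʳ u (∼-facet X Y ([] , [] , p))

  ∼-ext′ : ∀ {X Y} → Y ≈ rn X → (Y , true) ∷ (X , true) ∷ [] ∼ []
  ∼-ext′ {X} p = begin
    (_ , true) ∷ (X , true) ∷ []           ≈⟨ ∼-letter _ p ⟩
    (rn X , true) ∷ (X , true) ∷ []        ≈⟨ ∼-congˡ ((rn X , true) ∷ []) (∼-letter [] (sym (rn-invol X))) ⟩
    (rn X , true) ∷ (rn (rn X) , true) ∷ [] ≈⟨ ∼-ext (rn X) ⟩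
    []                                      ∎
    where open SetoidReasoning wordSetoid

  rn-letter : ∀ X → (rn X , true) ∷ [] ∼ (X , false) ∷ []
  rn-letter X = begin
    (rn X , true) ∷ []                                ≈⟨ ∼-congʳ ((rn X , true) ∷ []) (∼-inv₂ X) ⟨
    (X , false) ∷ (X , true) ∷ (rn X , true) ∷ []      ≈⟨ ∼-congˡ ((X , false) ∷ []) (∼-ext X) ⟩
    (X , false) ∷ []                                  ∎
    where open SetoidReasoning wordSetoid

  letter⁻¹ : Letter K → Letter K
  letter⁻¹ (X , b) = X , not b

  letter-inverseʳ : ∀ a → a ∷ letter⁻¹ a ∷ [] ∼ []
  letter-inverseʳ (X , true)  = ∼-inv₁ X
  letter-inverseʳ (X , false) = ∼-inv₂ X

  letter-inverseˡ : ∀ a → letter⁻¹ a ∷ a ∷ [] ∼ []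
  letter-inverseˡ (X , true)  = ∼-inv₂ X
  letter-inverseˡ (X , false) = ∼-inv₁ X

  inverse : Word K → Word K
  inverse []      = []
  inverse (a ∷ β) = inverse β ++ letter⁻¹ a ∷ []

  ++-inverseʳ : ∀ β → β ++ inverse β ∼ []
  ++-inverseʳ []      = ∼-refl
  ++-inverseʳ (a ∷ β) =
    subst₂ _∼_ (≡.cong (a ∷_) (++-assoc β (inverse β) _)) ≡.refl
      (∼-trans (∼-cong (a ∷ []) (letter⁻¹ a ∷ []) (++-inverseʳ β)) (letter-inverseʳ a))

  ++-inverseˡ : ∀ β → inverse β ++ β ∼ []
  ++-inverseˡ []      = ∼-refl
  ++-inverseˡ (a ∷ β) =
    subst₂ _∼_ (≡.sym (++-assoc (inverse β) _ (a ∷ β))) ≡.refl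
      (∼-trans (∼-congˡ (inverse β) (∼-congʳ β (letter-inverseˡ a))) (++-inverseˡ β))

split-inject₁ : ∀ m (j : Fin m) → split m (inject₁ j) ≡ just j
split-inject₁ (suc m) zero    = ≡.refl
split-inject₁ (suc m) (suc j) = ≡.cong (Maybe.map suc) (split-inject₁ m j)

split-fromℕ : ∀ m → split m (fromℕ m) ≡ nothing
split-fromℕ zero    = ≡.refl
split-fromℕ (suc m) = ≡.cong (Maybe.map suc) (split-fromℕ m)

module Cayley {n : ℕ} (K : RawPremaniplex n) (isM : IsManiplex K) where
  open RawPremaniplex K using (Flag; r; _≈_; refl; sym; trans; flags)
  open IsManiplex isM using (r-cong; connected)

  applyWordK-cong : ∀ w {x y} → x ≈ y → applyWord K w x ≈ applyWord K w y
  applyWordK-cong = applyWord-cong {M = K} r-cong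

  module UExt (R : PreExtender K) where
    open PreExtender R using (rn; rn-cong; rn-invol)
    open WordRel R
    open RawPremaniplex (U K R) using () renaming (_≈_ to _≈U_; reflexive to ≡⇒≈U)

    Ur-cong : AdjCong (U K R)
    Ur-cong i {Φ , γ} {Ψ , δ} (p , d) with split n i
    ... | just j  = r-cong j p , d
    ... | nothing = rn-cong p , ∼-trans (∼-letter γ p) (∼-congˡ ((Ψ , true) ∷ []) d)

    Ur-inject₁ : ∀ j Φ γ → Ur K R (inject₁ j) (Φ , γ) ≡ (r j Φ , γ)
    Ur-inject₁ j Φ γ rewrite split-inject₁ n j = ≡.refl

    Ur-top : ∀ Φ γ → Ur K R (fromℕ n) (Φ , γ) ≡ (rn Φ , (Φ , true) ∷ γ)
    Ur-top Φ γ rewrite split-fromℕ n = ≡.refl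

    applyWord-inject₁ : ∀ w Φ γ → applyWord (U K R) (map inject₁ w) (Φ , γ) ≡ (applyWord K w Φ , γ)
    applyWord-inject₁ []      Φ γ = ≡.refl
    applyWord-inject₁ (j ∷ w) Φ γ rewrite Ur-inject₁ j Φ γ = applyWord-inject₁ w (r j Φ) γ

    reachable-inLayer : ∀ {Φ Ψ} γ → Reachable K Φ Ψ → Reachable (U K R) (Φ , γ) (Ψ , γ)
    reachable-inLayer {Φ} γ (w , p) =
      map inject₁ w , RawPremaniplex.trans (U K R) (≡⇒≈U (applyWord-inject₁ w Φ γ)) (p , ∼-refl)

    reachable-α : ∀ X γ → Reachable (U K R) (X , γ) (rn X , (X , true) ∷ γ)
    reachable-α X γ = fromℕ n ∷ [] , ≡⇒≈U (Ur-top X γ)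

    reachable-α⁻¹ : ∀ X γ → Reachable (U K R) (rn X , γ) (X , (X , false) ∷ γ)
    reachable-α⁻¹ X γ =
      let (w , p) = reachable-α (rn X) γ in
      w , RawPremaniplex.trans (U K R) p (rn-invol X , ∼-congʳ γ (rn-letter X))

    U-reachable : ∀ Φ Ψ γ → Reachable (U K R) (Φ , []) (Ψ , γ)
    reachable-someFlag : ∀ Φ a γ → ∃ λ X → Reachable (U K R) (Φ , []) (X , a ∷ γ)

    U-reachable Φ Ψ [] = reachable-inLayer [] (connected Φ Ψ)
    U-reachable Φ Ψ (a ∷ γ) =
      let (X , p) = reachable-someFlag Φ a γ in
      Reachable-trans Ur-cong p (reachable-inLayer (a ∷ γ) (connected X Ψ))

    reachable-someFlag Φ (X , true)  γ =
      rn X , Reachable-trans Ur-cong (U-reachable Φ X γ) (reachable-α X γ)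
    reachable-someFlag Φ (X , false) γ =
      X , Reachable-trans Ur-cong (U-reachable Φ (rn X) γ) (reachable-α⁻¹ X γ)

    rightMul : Word K → Hom (U K R) (U K R)
    rightMul β = record { fun = fun ; fun-cong = λ (p , d) → p , ∼-congʳ β d ; fun-r = fun-r }
      where
      fun : FlagOf K × Word K → FlagOf K × Word K
      fun (Φ , γ) = Φ , γ ++ β
      fun-r : ∀ i x → fun (Ur K R i x) ≈U Ur K R i (fun x)
      fun-r i (Φ , γ) with split n i
      ... | just _  = refl , ∼-refl
      ... | nothing = refl , ∼-refl

    rightMulIso : Word K → Iso (U K R) (U K R)
    rightMulIso β = Iso-fromHoms (rightMul β) (rightMul (inverse β))
      (λ (Φ , γ) → refl , cancel γ β (inverse β) (++-inverseʳ β))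
      (λ (Φ , γ) → refl , cancel γ (inverse β) β (++-inverseˡ β))
      where
      cancel : ∀ γ u v → u ++ v ∼ [] → (γ ++ u) ++ v ∼ γ
      cancel γ u v d = subst₂ _∼_ (≡.sym (++-assoc γ u v)) (++-identityʳ γ) (∼-congˡ γ d)

  Aut : Set
  Aut = Iso K K

  ap : Aut → Flag → Flag
  ap = Iso.fwd

  infix 4 _≈ᴬ_
  record _≈ᴬ_ (g h : Aut) : Set where
    constructor pointwise
    field at : ∀ x → ap g x ≈ ap h x
  open _≈ᴬ_

  ≈ᴬ-sym : ∀ {g h} → g ≈ᴬ h → h ≈ᴬ g
  ≈ᴬ-sym p = pointwise λ x → sym (at p x)

  ≈ᴬ-trans : ∀ {f g h} → f ≈ᴬ g → g ≈ᴬ h → f ≈ᴬ h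
  ≈ᴬ-trans p q = pointwise λ x → trans (at p x) (at q x)

  ≡⇒≈ᴬ : ∀ {g h} → g ≡ h → g ≈ᴬ h
  ≡⇒≈ᴬ ≡.refl = pointwise λ _ → refl

  Aut-free : ∀ g h x → ap g x ≈ ap h x → g ≈ᴬ h
  Aut-free g h x gx≈hx = pointwise λ y →
    Hom-agreeOnReachable r-cong (Iso⇒Hom g) (Iso⇒Hom h) gx≈hx (connected x y)

  record FacetHom (f : Flag → Flag) : Set where
    field
      cong : ∀ {x y} → x ≈ y → f x ≈ f y
      comm : ∀ i x → NotTop i → f (r i x) ≈ r i (f x)

  Aut⇒FacetHom : ∀ g → FacetHom (ap g)
  Aut⇒FacetHom g = record { cong = Iso.fwd-cong g ; comm = λ i x _ → Iso.fwd-r g i x }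

  rn⇒FacetHom : (R : PreExtender K) → FacetHom (rnOf R)
  rn⇒FacetHom R = record { cong = PreExtender.rn-cong R ; comm = PreExtender.rn-comm R }

  FacetHom-∘ : ∀ {f g} → FacetHom f → FacetHom g → FacetHom (λ x → f (g x))
  FacetHom-∘ F G = record
    { cong = λ p → FacetHom.cong F (FacetHom.cong G p)
    ; comm = λ i x t → trans (FacetHom.cong F (FacetHom.comm G i x t)) (FacetHom.comm F i _ t) }

  FacetHom-applyWord : ∀ {f} → FacetHom f → ∀ {w} → All NotTop w → ∀ x →
                       f (applyWord K w x) ≈ applyWord K w (f x)
  FacetHom-applyWord F []       x = refl
  FacetHom-applyWord F {i ∷ w} (t ∷ ts) x =
    trans (FacetHom-applyWord F ts (r i x)) (applyWordK-cong w (FacetHom.comm F i x t))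

  SameFacet-map : ∀ {f Φ Ψ} → FacetHom f → SameFacet K Φ Ψ → SameFacet K (f Φ) (f Ψ)
  SameFacet-map {Φ = Φ} F (w , nt , p) =
    w , nt , trans (sym (FacetHom-applyWord F nt Φ)) (FacetHom.cong F p)

  FacetHom-agreeOnFacet : ∀ {f f′ Φ Ψ} → FacetHom f → FacetHom f′ →
                          f Φ ≈ f′ Φ → SameFacet K Φ Ψ → f Ψ ≈ f′ Ψ
  FacetHom-agreeOnFacet {f} {f′} {Φ} {Ψ} F F′ fΦ≈f′Φ (w , nt , wΦ≈Ψ) = begin
    f Ψ                  ≈⟨ FacetHom.cong F wΦ≈Ψ ⟨
    f (applyWord K w Φ)  ≈⟨ FacetHom-applyWord F nt Φ ⟩
    applyWord K w (f Φ)  ≈⟨ applyWordK-cong w fΦ≈f′Φ ⟩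
    applyWord K w (f′ Φ) ≈⟨ FacetHom-applyWord F′ nt Φ ⟨
    f′ (applyWord K w Φ) ≈⟨ FacetHom.cong F′ wΦ≈Ψ ⟩
    f′ Ψ                 ∎
    where open SetoidReasoning flags

  module Transport (reg : Regular K) (P Q : PreExtender K) where
    open PreExtender P using () renaming (rn to rP; rn-invol to rP-invol)
    open PreExtender Q using () renaming (rn to rQ; rn-cong to rQ-cong; rn-invol to rQ-invol)
    open WordRel Q using (_∼_; wordSetoid; ∼-congˡ; ∼-congʳ; ∼-letter; ∼-ext′)
    open RawPremaniplex (U K P) using () renaming (_≈_ to _≈P_)
    open RawPremaniplex (U K Q) using () renaming (_≈_ to _≈Q_)

    -- α_Φ⁻¹ = α_{rP Φ} in G(K,P), so every letter is α_X for X = pivot of the letter.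
    pivot : Letter K → Flag
    pivot (Φ , true)  = Φ
    pivot (Φ , false) = rP Φ

    cross : Letter K → Aut → Aut
    cross a g = proj₁ (reg (rP (pivot a)) (rQ (ap g (pivot a))))

    cross-spec : ∀ a g → ap (cross a g) (rP (pivot a)) ≈ rQ (ap g (pivot a))
    cross-spec a g = proj₂ (reg (rP (pivot a)) (rQ (ap g (pivot a))))

    aut : Aut → Word K → Aut
    aut g []      = g
    aut g (a ∷ γ) = cross a (aut g γ)

    word : Aut → Word K → Word K
    word g []      = []
    word g (a ∷ γ) = (ap (aut g γ) (pivot a) , true) ∷ word g γ

    aut-++ : ∀ g u v → aut g (u ++ v) ≡ aut (aut g v) u
    aut-++ g []      v = ≡.refl
    aut-++ g (a ∷ u) v = ≡.cong (cross a) (aut-++ g u v)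

    word-++ : ∀ g u v → word g (u ++ v) ≡ word (aut g v) u ++ word g v
    word-++ g []      v = ≡.refl
    word-++ g (a ∷ u) v = ≡.cong₂ _∷_ (≡.cong (λ h → ap h (pivot a) , true) (aut-++ g u v)) (word-++ g u v)

    cross-cong : ∀ a {g h} → g ≈ᴬ h → cross a g ≈ᴬ cross a h
    cross-cong a {g} {h} p = Aut-free _ _ (rP (pivot a))
      (trans (cross-spec a g) (trans (rQ-cong (at p (pivot a))) (sym (cross-spec a h))))

    aut-cong : ∀ γ {g h} → g ≈ᴬ h → aut g γ ≈ᴬ aut h γ
    aut-cong []      p = p
    aut-cong (a ∷ γ) p = cross-cong a (aut-cong γ p)

    word-cong : ∀ γ {g h} → g ≈ᴬ h → word g γ ∼ word h γ
    word-cong []      p = ∼-refl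
    word-cong (a ∷ γ) {g} {h} p =
      ∼-trans (∼-letter (word g γ) (at (aut-cong γ p) (pivot a)))
              (∼-congˡ ((ap (aut h γ) (pivot a) , true) ∷ []) (word-cong γ p))

    Respects : Word K → Word K → Set
    Respects u v = ∀ g → aut g u ≈ᴬ aut g v × word g u ∼ word g v

    cancelPair-respected : ∀ a b → pivot b ≈ rP (pivot a) → Respects (b ∷ a ∷ []) []
    cancelPair-respected a b p g = Aut-free τ g (rP (pivot b)) τ-agrees , ∼-ext′ σb≈rQga
      where
      σ = cross a g
      τ = cross b σ
      σb≈rQga : ap σ (pivot b) ≈ rQ (ap g (pivot a))
      σb≈rQga = trans (Iso.fwd-cong σ p) (cross-spec a g)
      τ-agrees : ap τ (rP (pivot b)) ≈ ap g (rP (pivot b))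
      τ-agrees = begin
        ap τ (rP (pivot b))          ≈⟨ cross-spec b σ ⟩
        rQ (ap σ (pivot b))          ≈⟨ rQ-cong σb≈rQga ⟩
        rQ (rQ (ap g (pivot a)))     ≈⟨ rQ-invol _ ⟩
        ap g (pivot a)               ≈⟨ Iso.fwd-cong g (trans (sym (rP-invol _)) (PreExtender.rn-cong P (sym p))) ⟩
        ap g (rP (pivot b))          ∎
        where open SetoidReasoning flags

    facet-respected : ∀ Φ Ψ → SameFacet K Φ Ψ → Respects ((Φ , true) ∷ []) ((Ψ , true) ∷ [])
    facet-respected Φ Ψ same g =
      Aut-free σ τ (rP Ψ) (trans σΨ≈ (sym (cross-spec (Ψ , true) g))) ,
      ∼-facet _ _ (SameFacet-map (Aut⇒FacetHom g) same)
      where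
      σ = cross (Φ , true) g
      τ = cross (Ψ , true) g
      σΨ≈ : ap σ (rP Ψ) ≈ rQ (ap g Ψ)
      σΨ≈ = FacetHom-agreeOnFacet (FacetHom-∘ (Aut⇒FacetHom σ) (rn⇒FacetHom P))
                                 (FacetHom-∘ (rn⇒FacetHom Q) (Aut⇒FacetHom g))
                                 (cross-spec (Φ , true) g) same

    cong-respected : ∀ a {u v} b → Respects u v → Respects (a ++ u ++ b) (a ++ v ++ b)
    cong-respected a {u} {v} b resp g = aut-eq , word-eq
      where
      auts : aut g (u ++ b) ≈ᴬ aut g (v ++ b)
      auts = ≈ᴬ-trans (≡⇒≈ᴬ (aut-++ g u b))
               (≈ᴬ-trans (proj₁ (resp (aut g b))) (≡⇒≈ᴬ (≡.sym (aut-++ g v b))))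
      aut-eq : aut g (a ++ u ++ b) ≈ᴬ aut g (a ++ v ++ b)
      aut-eq = ≈ᴬ-trans (≡⇒≈ᴬ (aut-++ g a (u ++ b)))
                 (≈ᴬ-trans (aut-cong a auts) (≡⇒≈ᴬ (≡.sym (aut-++ g a (v ++ b)))))
      word-++₃ : ∀ w → word g (a ++ w ++ b) ≡ word (aut g (w ++ b)) a ++ word (aut g b) w ++ word g b
      word-++₃ w = ≡.trans (word-++ g a (w ++ b)) (≡.cong (word (aut g (w ++ b)) a ++_) (word-++ g w b))
      word-eq : word g (a ++ u ++ b) ∼ word g (a ++ v ++ b)
      word-eq = begin
        word g (a ++ u ++ b)                                           ≡⟨ word-++₃ u ⟩
        word (aut g (u ++ b)) a ++ word (aut g b) u ++ word g b        ≈⟨ ∼-congʳ _ (word-cong a auts) ⟩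
        word (aut g (v ++ b)) a ++ word (aut g b) u ++ word g b        ≈⟨ ∼-cong (word (aut g (v ++ b)) a) (word g b) (proj₂ (resp (aut g b))) ⟩
        word (aut g (v ++ b)) a ++ word (aut g b) v ++ word g b        ≡⟨ word-++₃ v ⟨
        word g (a ++ v ++ b)                                           ∎
        where open SetoidReasoning wordSetoid

    respects : ∀ {u v} → u ∼⟨ P ⟩ v → Respects u v
    respects ∼-refl            g = pointwise (λ _ → refl) , ∼-refl
    respects (∼-sym d)         g = let (p , q) = respects d g in ≈ᴬ-sym p , ∼-sym q
    respects (∼-trans d e)     g = let (p , q) = respects d g ; (p′ , q′) = respects e g in
                                   ≈ᴬ-trans p p′ , ∼-trans q q′
    respects (∼-cong a b d)    = cong-respected a b (respects d)
    respects (∼-inv₁ Φ)        = cancelPair-respected (Φ , false) (Φ , true) (sym (rP-invol Φ))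
    respects (∼-inv₂ Φ)        = cancelPair-respected (Φ , true) (Φ , false) refl
    respects (∼-facet Φ Ψ s)   = facet-respected Φ Ψ s
    respects (∼-ext Φ)         = cancelPair-respected (rP Φ , true) (Φ , true) (sym (rP-invol Φ))

    transport : Aut → Hom (U K P) (U K Q)
    transport g = record { fun = fun ; fun-cong = fun-cong ; fun-r = fun-r }
      where
      fun : FlagOf K × Word K → FlagOf K × Word K
      fun (Φ , γ) = ap (aut g γ) Φ , word g γ
      fun-cong : ∀ {x y} → x ≈P y → fun x ≈Q fun y
      fun-cong {Φ , γ} {Ψ , δ} (p , d) =
        trans (Iso.fwd-cong (aut g γ) p) (at (proj₁ (respects d g)) Ψ) , proj₂ (respects d g)
      fun-r : ∀ i x → fun (Ur K P i x) ≈Q Ur K Q i (fun x)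
      fun-r i (Φ , γ) with split n i
      ... | just j  = Iso.fwd-r (aut g γ) j Φ , ∼-refl
      ... | nothing = cross-spec (Φ , true) (aut g γ) , ∼-refl

  transportIso : Regular K → (P Q : PreExtender K) → Aut → Iso (U K P) (U K Q)
  transportIso reg P Q g =
    Iso-fromLocalInverses (UExt.Ur-cong P) (UExt.Ur-cong Q)
      (Transport.transport reg P Q g) (Transport.transport reg Q P (Iso-sym r-cong g))
      (λ (Φ , γ) → (Φ , []) , (Iso.bwd-fwd g Φ , ∼-refl) , UExt.U-reachable P Φ Φ γ)
      (λ (Ψ , δ) → (Ψ , []) , (Iso.fwd-bwd g Ψ , ∼-refl) , UExt.U-reachable Q Ψ Ψ δ)

  U-unique : Regular K → (P Q : PreExtender K) → Iso (U K P) (U K Q)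
  U-unique reg P Q = transportIso reg P Q Iso-id

  U-regular : Regular K → (P : PreExtender K) → Regular (U K P)
  U-regular reg P (Φ , γ) (Ψ , δ) = Iso-trans (rightMulIso (inverse γ)) φ , φ-maps
    where
    open UExt P using (rightMulIso)
    open WordRel P using (inverse; ++-inverseʳ)
    open RawPremaniplex (U K P) using () renaming (_≈_ to _≈U_; trans to transU)
    φ = Iso-trans (transportIso reg P P (proj₁ (reg Φ Ψ))) (rightMulIso δ)
    φ-maps : Iso.fwd φ (Φ , γ ++ inverse γ) ≈U (Ψ , δ)
    φ-maps = transU (Iso.fwd-cong φ (refl , ++-inverseʳ γ)) (proj₂ (reg Φ Ψ) , ∼-refl)

corollary5p26 : ∀ {n} (K : RawPremaniplex n) → IsManiplex K → Regular K →
    (P Q : PreExtender K) → Iso (U K P) (U K Q) × Regular (U K P)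
corollary5p26 K isM reg P Q = U-unique reg P Q , U-regular reg P
  where open Cayley K isM
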